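{- The category $\mathbf{OFrm}$ is complete.
   Context: Work in intuitionistic logic without choice. A positivity predicate on a complete lattice $L$ is a unary predicate $\mathrm{Pos}$ such that: (i) $\mathrm{Pos}(x)$ and $x\le y$ imply $\mathrm{Pos}(y)$; (ii) $\mathrm{Pos}(\bigvee X)$ implies $\mathrm{Pos}(x)$ for some $x\in X$; (iii) if $\mathrm{Pos}(x)\Rightarrow x\le y$, then $x\le y$. An o-algebra is a frame $L$ with a positivity predicate such that for all $x,y$: if $\mathrm{Pos}(z\wedge x)\Rightarrow\mathrm{Pos}(z\wedge y)$ for every $z\in L$, then $x\le y$. Write $x\bowtie y$ (overlap) for $\mathrm{Pos}(x\wedge y)$. Functions $f:L\to M$, $g:M\to L$ are symmetric if $f(x)\bowtie y\iff x\bowtie g(y)$; $f$ is symmetrizable if it has a (unique) symmetric $f^\dagger$. $\mathbf{OFrm}$ is the category of o-algebras and symmetrizable functions that preserve finite meets (equivalently, open frame homomorphisms between o-algebras). -}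

module Defs where

open import Level using (Level; _⊔_) renaming (suc to lsuc)
open import Data.Product using (Σ; ∃; _×_; _,_; proj₁; proj₂)
open import Relation.Binary using (Rel; IsEquivalence)

record Category (o m e : Level) : Set (lsuc (o ⊔ m ⊔ e)) where
  infixr 9 _∘_
  infix  4 _≈_
  field
    Obj       : Set o
    Hom       : Obj → Obj → Set m
    _≈_       : ∀ {A B} → Rel (Hom A B) e
    ≈-equiv   : ∀ {A B} → IsEquivalence (_≈_ {A} {B})
    id        : ∀ {A} → Hom A A
    _∘_       : ∀ {A B C} → Hom B C → Hom A B → Hom A C
    identityˡ : ∀ {A B} {f : Hom A B} → id ∘ f ≈ f
    identityʳ : ∀ {A B} {f : Hom A B} → f ∘ id ≈ f
    assoc     : ∀ {A B C D} {f : Hom A B} {g : Hom B C} {h : Hom C D} →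
                (h ∘ g) ∘ f ≈ h ∘ (g ∘ f)
    ∘-resp-≈  : ∀ {A B C} {f f′ : Hom B C} {g g′ : Hom A B} →
                f ≈ f′ → g ≈ g′ → f ∘ g ≈ f′ ∘ g′

record Functor {o m e o′ m′ e′ : Level}
               (J : Category o m e) (C : Category o′ m′ e′)
               : Set (o ⊔ m ⊔ e ⊔ o′ ⊔ m′ ⊔ e′) where
  private
    module J = Category J
    module C = Category C
  field
    F₀           : J.Obj → C.Obj
    F₁           : ∀ {A B} → J.Hom A B → C.Hom (F₀ A) (F₀ B)
    identity     : ∀ {A} → F₁ (J.id {A}) C.≈ C.id
    homomorphism : ∀ {A B D} {f : J.Hom A B} {g : J.Hom B D} →
                   F₁ (g J.∘ f) C.≈ F₁ g C.∘ F₁ f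
    F-resp-≈     : ∀ {A B} {f g : J.Hom A B} → f J.≈ g → F₁ f C.≈ F₁ g

module _ {o m e o′ m′ e′ : Level} {J : Category o m e} {C : Category o′ m′ e′}
         (F : Functor J C) where
  private
    module J = Category J
    module C = Category C
    module F = Functor F

  record Cone : Set (o ⊔ m ⊔ o′ ⊔ m′ ⊔ e′) where
    field
      apex    : C.Obj
      ψ       : ∀ j → C.Hom apex (F.F₀ j)
      commute : ∀ {i j} (u : J.Hom i j) → F.F₁ u C.∘ ψ i C.≈ ψ j

  record Limit : Set (o ⊔ m ⊔ o′ ⊔ m′ ⊔ e′) where
    field
      limit : Cone
    open Cone limit
    field
      universal : (K : Cone) →
        Σ (C.Hom (Cone.apex K) apex) λ h →
          (∀ j → ψ j C.∘ h C.≈ Cone.ψ K j) ×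
          (∀ (h′ : C.Hom (Cone.apex K) apex) →
             (∀ j → ψ j C.∘ h′ C.≈ Cone.ψ K j) → h′ C.≈ h)

Complete : {o′ m′ e′ : Level} (o m e : Level) → Category o′ m′ e′ →
           Set (lsuc (o ⊔ m ⊔ e) ⊔ o′ ⊔ m′ ⊔ e′)
Complete o m e C = (J : Category o m e) (F : Functor J C) → Limit F

record OAlg (ℓ : Level) : Set (lsuc (lsuc ℓ)) where
  infix  4 _≤_ _≈_ _⋈_
  infixr 7 _∧_
  field
    Carrier  : Set (lsuc ℓ)
    _≤_      : Carrier → Carrier → Set ℓ
    ≤-refl   : ∀ {x} → x ≤ x
    ≤-trans  : ∀ {x y z} → x ≤ y → y ≤ z → x ≤ z
    ⊤        : Carrier
    ⊤-max    : ∀ {x} → x ≤ ⊤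
    _∧_      : Carrier → Carrier → Carrier
    ∧-lbˡ    : ∀ {x y} → x ∧ y ≤ x
    ∧-lbʳ    : ∀ {x y} → x ∧ y ≤ y
    ∧-glb    : ∀ {x y z} → z ≤ x → z ≤ y → z ≤ x ∧ y
    ⋁        : {I : Set ℓ} → (I → Carrier) → Carrier
    ⋁-ub     : ∀ {I : Set ℓ} (f : I → Carrier) (i : I) → f i ≤ ⋁ f
    ⋁-lub    : ∀ {I : Set ℓ} (f : I → Carrier) {y} → (∀ i → f i ≤ y) → ⋁ f ≤ y
    distrib  : ∀ {I : Set ℓ} (x : Carrier) (f : I → Carrier) →
               x ∧ ⋁ f ≤ ⋁ (λ i → x ∧ f i)
    Pos      : Carrier → Set ℓ
    Pos-mono : ∀ {x y} → Pos x → x ≤ y → Pos y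
    Pos-⋁    : ∀ {I : Set ℓ} (f : I → Carrier) → Pos (⋁ f) → ∃ λ i → Pos (f i)
    Pos-≤    : ∀ {x y} → (Pos x → x ≤ y) → x ≤ y
    Pos-sep  : ∀ {x y} → (∀ z → Pos (z ∧ x) → Pos (z ∧ y)) → x ≤ y

  _≈_ : Carrier → Carrier → Set ℓ
  x ≈ y = (x ≤ y) × (y ≤ x)

  _⋈_ : Carrier → Carrier → Set ℓ
  x ⋈ y = Pos (x ∧ y)

record OHom {ℓ : Level} (L M : OAlg ℓ) : Set (lsuc ℓ) where
  private
    module L = OAlg L
    module M = OAlg M
  field
    fun      : L.Carrier → M.Carrier
    fun-cong : ∀ {x y} → x L.≈ y → fun x M.≈ fun y
    pres-⊤   : fun L.⊤ M.≈ M.⊤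
    pres-∧   : ∀ x y → fun (x L.∧ y) M.≈ (fun x M.∧ fun y)
    symm     : Σ (M.Carrier → L.Carrier) λ g →
                 ∀ x y → (fun x M.⋈ y → x L.⋈ g y) × (x L.⋈ g y → fun x M.⋈ y)

module _ {ℓ : Level} where
  open OAlg
  open OHom

  private
    ≈-refl : (L : OAlg ℓ) {x : Carrier L} → _≈_ L x x
    ≈-refl L = ≤-refl L , ≤-refl L
    ≈-sym : (L : OAlg ℓ) {x y : Carrier L} → _≈_ L x y → _≈_ L y x
    ≈-sym L (p , q) = q , p
    ≈-trans : (L : OAlg ℓ) {x y z : Carrier L} → _≈_ L x y → _≈_ L y z → _≈_ L x z
    ≈-trans L (p , q) (p′ , q′) = ≤-trans L p p′ , ≤-trans L q′ q

  _≗ₒ_ : {L M : OAlg ℓ} → OHom L M → OHom L M → Set (lsuc ℓ)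
  _≗ₒ_ {L} {M} f g = ∀ x → _≈_ M (fun f x) (fun g x)

  idₒ : {L : OAlg ℓ} → OHom L L
  idₒ {L} = record
    { fun = λ x → x ; fun-cong = λ p → p ; pres-⊤ = ≈-refl L
    ; pres-∧ = λ _ _ → ≈-refl L
    ; symm = (λ y → y) , λ _ _ → (λ p → p) , (λ p → p) }

  _∘ₒ_ : {L M N : OAlg ℓ} → OHom M N → OHom L M → OHom L N
  _∘ₒ_ {L} {M} {N} g f = record
    { fun = λ x → fun g (fun f x)
    ; fun-cong = λ p → fun-cong g (fun-cong f p)
    ; pres-⊤ = ≈-trans N (fun-cong g (pres-⊤ f)) (pres-⊤ g)
    ; pres-∧ = λ x y → ≈-trans N (fun-cong g (pres-∧ f x y)) (pres-∧ g _ _)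
    ; symm = (λ z → proj₁ (symm f) (proj₁ (symm g) z))
           , λ x z → (λ p → proj₁ (proj₂ (symm f) x _) (proj₁ (proj₂ (symm g) _ z) p))
                   , (λ p → proj₂ (proj₂ (symm g) _ z) (proj₂ (proj₂ (symm f) x _) p))
    }

  OFrm : Category (lsuc (lsuc ℓ)) (lsuc ℓ) (lsuc ℓ)
  OFrm = record
    { Obj = OAlg ℓ
    ; Hom = OHom
    ; _≈_ = _≗ₒ_
    ; ≈-equiv = λ {A} {B} → record
        { refl = λ x → ≈-refl B
        ; sym = λ p x → ≈-sym B (p x)
        ; trans = λ p q x → ≈-trans B (p x) (q x) }
    ; id = idₒ
    ; _∘_ = _∘ₒ_
    ; identityˡ = λ {A} {B} x → ≈-refl B
    ; identityʳ = λ {A} {B} x → ≈-refl B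
    ; assoc = λ {A} {B} {C} {D} x → ≈-refl D
    ; ∘-resp-≈ = λ {A} {B} {C} {f} {f′} {g} {g′} p q x →
        ≈-trans C (fun-cong f (q x)) (p (fun g′ x))
    }

module Submission where

-- The limit is carried by the compatible families (x_j)_j, x_j ∈ F j, with
-- F u (x_a) ≈ x_b for every u : a → b.  Order, finite meets and joins are
-- computed componentwise; this works because morphisms of OFrm preserve
-- finite meets and, being symmetrizable, also all joins.  A family is
-- positive when some component is.  The adjoint of the projection π_j sends
-- w ∈ F j to the family it generates: its k-th component is the join of all
-- images of w along zigzags j → k, which step forwards by F u and backwards
-- by (F u)†.  The key lemma is that overlap with a compatible family is
-- invariant along zigzags; it yields the symmetry law of π_j, and the
-- o-algebra separation axiom of the limit follows from that law applied to
-- generated families.  Given a cone ψ, the mediating map is a ↦ (ψ_j a)_j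
-- with adjoint x ↦ ⋁_j ψ_j†(x_j); uniqueness is immediate.

open import Defs
open import Level using (Level)
open import Data.Product using (∃; _,_; proj₁; proj₂)

module OAlgFacts {ℓ : Level} (L : OAlg ℓ) where
  open OAlg L

  ≈-refl : ∀ {x} → x ≈ x
  ≈-refl = ≤-refl , ≤-refl

  ≈-trans : ∀ {x y z} → x ≈ y → y ≈ z → x ≈ z
  ≈-trans (p , q) (p′ , q′) = ≤-trans p p′ , ≤-trans q′ q

  ∧-mono : ∀ {x x′ y y′} → x ≤ x′ → y ≤ y′ → x ∧ y ≤ x′ ∧ y′
  ∧-mono p q = ∧-glb (≤-trans ∧-lbˡ p) (≤-trans ∧-lbʳ q)

  ∧-cong : ∀ {x x′ y y′} → x ≈ x′ → y ≈ y′ → x ∧ y ≈ x′ ∧ y′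
  ∧-cong (p , q) (p′ , q′) = ∧-mono p p′ , ∧-mono q q′

  ⋁-cong : ∀ {I : Set ℓ} {f g : I → Carrier} → (∀ i → f i ≈ g i) → ⋁ f ≈ ⋁ g
  ⋁-cong {f = f} {g} e =
    ⋁-lub f (λ i → ≤-trans (proj₁ (e i)) (⋁-ub g i)) ,
    ⋁-lub g (λ i → ≤-trans (proj₂ (e i)) (⋁-ub f i))

  ⋈-sym : ∀ {x y} → x ⋈ y → y ⋈ x
  ⋈-sym p = Pos-mono p (∧-glb ∧-lbʳ ∧-lbˡ)

  ⋈-mono : ∀ {x x′ y y′} → x ≤ x′ → y ≤ y′ → x ⋈ y → x′ ⋈ y′
  ⋈-mono p q r = Pos-mono r (∧-mono p q)

  ⋈-⋁ : ∀ {I : Set ℓ} x (f : I → Carrier) → x ⋈ ⋁ f → ∃ λ i → x ⋈ f i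
  ⋈-⋁ x f p = Pos-⋁ _ (Pos-mono p (distrib x f))

  ⋈-ub : ∀ {I : Set ℓ} {x} (f : I → Carrier) i → x ⋈ f i → x ⋈ ⋁ f
  ⋈-ub f i = ⋈-mono ≤-refl (⋁-ub f i)

module SymmetrizableFacts {ℓ : Level} {L M : OAlg ℓ} (h : OHom L M) where
  private
    module L = OAlg L
    module M = OAlg M
    module L′ = OAlgFacts L
    module M′ = OAlgFacts M
  open OHom h

  f† : M.Carrier → L.Carrier
  f† = proj₁ symm

  transpose : ∀ x y → fun x M.⋈ y → x L.⋈ f† y
  transpose x y = proj₁ (proj₂ symm x y)

  transpose⁻ : ∀ x y → x L.⋈ f† y → fun x M.⋈ y
  transpose⁻ x y = proj₂ (proj₂ symm x y)

  -- Monotonicity follows from preservation of binary meets.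
  mono : ∀ {x y} → x L.≤ y → fun x M.≤ fun y
  mono {x} {y} p =
    M.≤-trans (proj₁ (fun-cong (L.∧-glb L.≤-refl p , L.∧-lbˡ)))
              (M.≤-trans (proj₁ (pres-∧ x y)) M.∧-lbʳ)

  †-mono : ∀ {x y} → x M.≤ y → f† x L.≤ f† y
  †-mono {x} {y} p = L.Pos-sep λ z q →
    transpose z y (M′.⋈-mono M.≤-refl p (transpose⁻ z x q))

  -- f reflects positivity: Pos (f x) gives f x ⋈ ⊤, hence x ⋈ f† ⊤.
  Pos-reflect : ∀ {x} → M.Pos (fun x) → L.Pos x
  Pos-reflect {x} p =
    L.Pos-mono (transpose x M.⊤ (M.Pos-mono p (M.∧-glb M.≤-refl M.⊤-max))) L.∧-lbˡ

  ⋈-reflect : ∀ x y → fun x M.⋈ fun y → x L.⋈ y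
  ⋈-reflect x y p = Pos-reflect (M.Pos-mono p (proj₂ (pres-∧ x y)))

  ⋁-pres : ∀ {I : Set ℓ} (g : I → L.Carrier) → fun (L.⋁ g) M.≈ M.⋁ (λ i → fun (g i))
  ⋁-pres g = M.Pos-sep below , M.⋁-lub _ (λ i → mono (L.⋁-ub g i))
    where
    below : ∀ z → M.Pos (z M.∧ fun (L.⋁ g)) → M.Pos (z M.∧ M.⋁ (λ i → fun (g i)))
    below z q with L′.⋈-⋁ (f† z) g (L′.⋈-sym (transpose (L.⋁ g) z (M′.⋈-sym q)))
    ... | i , r = M′.⋈-ub (λ i → fun (g i)) i (M′.⋈-sym (transpose⁻ (g i) z (L′.⋈-sym r)))

  unit : ∀ {v} → v M.≤ fun (f† v)
  unit {v} = M.Pos-sep λ z q →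
    let f⊤⋈zv : fun L.⊤ M.⋈ (z M.∧ v)
        f⊤⋈zv = M.Pos-mono q (M.∧-glb (M.≤-trans M.⊤-max (proj₂ pres-⊤)) M.≤-refl)
        pos†zv : L.Pos (f† (z M.∧ v))
        pos†zv = L.Pos-mono (transpose L.⊤ _ f⊤⋈zv) L.∧-lbʳ
        †v⋈†z : f† v L.⋈ f† z
        †v⋈†z = L.Pos-mono pos†zv (L.∧-glb (†-mono M.∧-lbʳ) (†-mono M.∧-lbˡ))
    in M′.⋈-sym (transpose⁻ (f† v) z †v⋈†z)

module LimitConstruction {ℓ : Level} (J : Category ℓ ℓ ℓ) (F : Functor J (OFrm {ℓ})) where
  private
    module J = Category J
    module F = Functor F
    module Sym {a b} (u : J.Hom a b) = SymmetrizableFacts (F.F₁ u)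
  open OAlg
  open OHom

  C : J.Obj → OAlg ℓ
  C = F.F₀

  private
    module C j = OAlgFacts (C j)

  Fᵤ : ∀ {a b} → J.Hom a b → Carrier (C a) → Carrier (C b)
  Fᵤ u = fun (F.F₁ u)

  record Family : Set (Level.suc ℓ) where
    field
      el     : ∀ j → Carrier (C j)
      compat : ∀ {a b} (u : J.Hom a b) → _≈_ (C b) (Fᵤ u (el a)) (el b)
  open Family

  _⊑_ : Family → Family → Set ℓ
  x ⊑ y = ∀ j → _≤_ (C j) (el x j) (el y j)

  ⊤ᶠ : Family
  ⊤ᶠ = record { el = λ j → ⊤ (C j) ; compat = λ u → pres-⊤ (F.F₁ u) }

  _⊓_ : Family → Family → Family
  x ⊓ y = record
    { el = λ j → _∧_ (C j) (el x j) (el y j)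
    ; compat = λ {a} {b} u →
        C.≈-trans b (pres-∧ (F.F₁ u) (el x a) (el y a)) (C.∧-cong b (compat x u) (compat y u))
    }

  ⨆ : {I : Set ℓ} → (I → Family) → Family
  ⨆ f = record
    { el = λ j → ⋁ (C j) (λ i → el (f i) j)
    ; compat = λ {a} {b} u →
        C.≈-trans b (Sym.⋁-pres u _) (C.⋁-cong b (λ i → compat (f i) u))
    }

  Posᶠ : Family → Set ℓ
  Posᶠ x = ∃ λ j → Pos (C j) (el x j)

  _⋈ᶠ_ : Family → Family → Set ℓ
  x ⋈ᶠ y = Posᶠ (x ⊓ y)

  ⋈ᶠ-sym : ∀ x y → x ⋈ᶠ y → y ⋈ᶠ x
  ⋈ᶠ-sym x y (j , p) = j , C.⋈-sym j p

  data Zigzag (j : J.Obj) : J.Obj → Set ℓ where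
    nil : Zigzag j j
    fw  : ∀ {a b} → Zigzag j a → J.Hom a b → Zigzag j b
    bw  : ∀ {a b} → Zigzag j b → J.Hom a b → Zigzag j a

  transport : ∀ {j k} → Zigzag j k → Carrier (C j) → Carrier (C k)
  transport nil       w = w
  transport (fw p u) w = Fᵤ u (transport p w)
  transport (bw p u) w = Sym.f† u (transport p w)

  zigzag-⋈ : (x : Family) → ∀ {j k} (p : Zigzag j k) (w : Carrier (C j)) →
             _⋈_ (C k) (el x k) (transport p w) → _⋈_ (C j) (el x j) w
  zigzag-⋈ x nil      w q = q
  zigzag-⋈ x (fw {a} {b} p u) w q =
    zigzag-⋈ x p w (Sym.⋈-reflect u (el x a) (transport p w)
      (C.⋈-mono b (proj₂ (compat x u)) (≤-refl (C b)) q))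
  zigzag-⋈ x (bw {a} {b} p u) w q =
    zigzag-⋈ x p w (C.⋈-mono b (proj₁ (compat x u)) (≤-refl (C b))
      (Sym.transpose⁻ u (el x a) (transport p w) q))

  -- The compatible family generated by w ∈ C j; it will be the adjoint of π_j.
  generated : ∀ j → Carrier (C j) → Family
  generated j w = record
    { el = component
    ; compat = λ {a} {b} u →
        ≤-trans (C b) (proj₁ (Sym.⋁-pres u _))
          (⋁-lub (C b) _ λ p → ⋁-ub (C b) (reach b) (fw p u))
      , ⋁-lub (C b) _ λ p → ≤-trans (C b) (Sym.unit u)
          (Sym.mono u (⋁-ub (C a) (reach a) (bw p u)))
    }
    where
    reach : ∀ k → Zigzag j k → Carrier (C k)
    reach k p = transport p w
    component : ∀ k → Carrier (C k)
    component k = ⋁ (C k) (reach k)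

  generated-self : ∀ j w → _≤_ (C j) w (el (generated j w) j)
  generated-self j w = ⋁-ub (C j) (λ p → transport p w) nil

  π-symm⁺ : ∀ j x w → _⋈_ (C j) (el x j) w → x ⋈ᶠ generated j w
  π-symm⁺ j x w q = j , C.⋈-mono j (≤-refl (C j)) (generated-self j w) q

  π-symm⁻ : ∀ j x w → x ⋈ᶠ generated j w → _⋈_ (C j) (el x j) w
  π-symm⁻ j x w (k , q) with C.⋈-⋁ k (el x k) _ q
  ... | p , r = zigzag-⋈ x p w r

  -- Separation axiom for compatible families, tested against generated families.
  separation : ∀ {x y} → (∀ z → z ⋈ᶠ x → z ⋈ᶠ y) → x ⊑ y
  separation {x} {y} h k = Pos-sep (C k) λ w q →
    let z = generated k w
        z⋈x : z ⋈ᶠ x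
        z⋈x = ⋈ᶠ-sym x z (π-symm⁺ k x w (C.⋈-sym k q))
    in C.⋈-sym k (π-symm⁻ k y w (⋈ᶠ-sym z y (h z z⋈x)))

  Lim : OAlg ℓ
  Lim = record
    { Carrier = Family
    ; _≤_ = _⊑_
    ; ≤-refl = λ j → ≤-refl (C j)
    ; ≤-trans = λ p q j → ≤-trans (C j) (p j) (q j)
    ; ⊤ = ⊤ᶠ
    ; ⊤-max = λ j → ⊤-max (C j)
    ; _∧_ = _⊓_
    ; ∧-lbˡ = λ j → ∧-lbˡ (C j)
    ; ∧-lbʳ = λ j → ∧-lbʳ (C j)
    ; ∧-glb = λ p q j → ∧-glb (C j) (p j) (q j)
    ; ⋁ = ⨆
    ; ⋁-ub = λ f i j → ⋁-ub (C j) (λ i → el (f i) j) i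
    ; ⋁-lub = λ f p j → ⋁-lub (C j) _ λ i → p i j
    ; distrib = λ x f j → distrib (C j) (el x j) (λ i → el (f i) j)
    ; Pos = Posᶠ
    ; Pos-mono = λ { (j , p) q → j , Pos-mono (C j) p (q j) }
    ; Pos-⋁ = λ { f (j , p) → let (i , q) = Pos-⋁ (C j) _ p in i , j , q }
    ; Pos-≤ = λ h j → Pos-≤ (C j) λ p → h (j , p) j
    ; Pos-sep = λ {x} {y} → separation {x} {y}
    }

  π : ∀ j → OHom Lim (C j)
  π j = record
    { fun = λ x → el x j
    ; fun-cong = λ p → proj₁ p j , proj₂ p j
    ; pres-⊤ = C.≈-refl j
    ; pres-∧ = λ _ _ → C.≈-refl j
    ; symm = generated j , λ x w → π-symm⁺ j x w , π-symm⁻ j x w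
    }

  cone : Cone F
  cone = record { apex = Lim ; ψ = π ; commute = λ u x → compat x u }

  mediator : (K : Cone F) → OHom (Cone.apex K) Lim
  mediator K = record
    { fun = tuple
    ; fun-cong = λ p → (λ j → proj₁ (fun-cong (ψ j) p)) , (λ j → proj₂ (fun-cong (ψ j) p))
    ; pres-⊤ = (λ j → proj₁ (pres-⊤ (ψ j))) , (λ j → proj₂ (pres-⊤ (ψ j)))
    ; pres-∧ = λ x y → (λ j → proj₁ (pres-∧ (ψ j) x y)) , (λ j → proj₂ (pres-∧ (ψ j) x y))
    ; symm = cotuple , λ a x → symm⁺ a x , symm⁻ a x
    }
    where
    open Cone K using (apex; ψ; commute)
    module A = OAlgFacts apex
    module ψ j = SymmetrizableFacts (ψ j)

    tuple : Carrier apex → Family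
    tuple a = record { el = λ j → fun (ψ j) a ; compat = λ u → commute u a }

    cotuple : Family → Carrier apex
    cotuple x = ⋁ apex (λ j → ψ.f† j (el x j))

    symm⁺ : ∀ a x → tuple a ⋈ᶠ x → _⋈_ apex a (cotuple x)
    symm⁺ a x (k , q) = A.⋈-ub (λ j → ψ.f† j (el x j)) k (ψ.transpose k a (el x k) q)

    symm⁻ : ∀ a x → _⋈_ apex a (cotuple x) → tuple a ⋈ᶠ x
    symm⁻ a x q with A.⋈-⋁ a _ q
    ... | j , r = j , ψ.transpose⁻ j a (el x j) r

  limit : Limit F
  limit = record
    { limit = cone
    ; universal = λ K →
        mediator K
        , (λ j a → C.≈-refl j)
        , λ _ factors a → (λ j → proj₁ (factors j a)) , (λ j → proj₂ (factors j a))
    }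

proposition5p4 : ∀ {ℓ : Level} → Complete ℓ ℓ ℓ (OFrm {ℓ})
proposition5p4 J F = LimitConstruction.limit J F
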